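{- Let $n\ge 1$. The type $C_n$ zeta map $\zeta_C:\mathcal L_{n,n}\to\mathcal B_{2n}$ is a bijection.
   Context: For $a,b\ge 0$, $\mathcal L_{a,b}$ is the set of words in the letters $N$ (North step) and $E$ (East step) containing exactly $a$ letters $E$ and $b$ letters $N$. $\mathcal B_m$ is the set of words of length $m$ in $\{N,E\}$ such that every prefix contains at least as many $N$'s as $E$'s (ballot paths). For an integer vector $a=(a_1,\dots,a_n)$ and an integer $j\ge0$ define words in $\{N,E\}$: $\overrightarrow{S}^+_j(a)$ is obtained by reading $a_1,a_2,\dots,a_n$ from left to right, writing $N$ for each entry equal to $j$ and $E$ for each entry equal to $j+1$ (other entries are ignored); $\overleftarrow{S}^+_j(a)$ is defined the same way but reading $a$ from right to left; $\overrightarrow{S}^-_j(a)$ (resp. $\overleftarrow{S}^-_j(a)$) is obtained by reading $a$ from left to right (resp. right to left), writing $N$ for each entry equal to $-j$ and $E$ for each entry equal to $-j-1$. For $\pi\in\mathcal L_{n,n}$ let $\lambda_i$ be the number of East steps of $\pi$ preceding its $i$-th North step ($1\le i\le n$), and define the type $C_n$ area vector $\mu=(\mu_1,\dots,\mu_n)$ by $\mu_i=(n+1-i)-\lambda_{n+1-i}$. Then $\zeta_C(\pi)$ is the concatenation $\overleftarrow{S}^-_n(\mu)\overrightarrow{S}^+_n(\mu)\overleftarrow{S}^-_{n-1}(\mu)\overrightarrow{S}^+_{n-1}(\mu)\cdots\overleftarrow{S}^-_0(\mu)\overrightarrow{S}^+_0(\mu)$. -}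

module Defs where

open import Data.Nat using (ℕ; zero; suc; _≤_)
open import Data.Integer as ℤ using (ℤ; +_; -_; _⊖_)
open import Data.List using (List; []; _∷_; _++_; take; length; reverse; zipWith; map; upTo)
open import Data.Product using (_×_)
open import Relation.Binary.PropositionalEquality using (_≡_)
open import Relation.Nullary using (yes; no)

data Step : Set where
  N E : Step

countN : List Step → ℕ
countN [] = 0
countN (N ∷ w) = suc (countN w)
countN (E ∷ w) = countN w

countE : List Step → ℕ
countE [] = 0
countE (N ∷ w) = countE w
countE (E ∷ w) = suc (countE w)

InL : ℕ → ℕ → List Step → Set
InL a b w = (countE w ≡ a) × (countN w ≡ b)

InB : ℕ → List Step → Set
InB m w = (length w ≡ m) × (∀ k → countE (take k w) ≤ countN (take k w))

lambdasAux : ℕ → List Step → List ℕ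
lambdasAux e [] = []
lambdasAux e (N ∷ w) = e ∷ lambdasAux e w
lambdasAux e (E ∷ w) = lambdasAux (suc e) w

lambdas : List Step → List ℕ
lambdas = lambdasAux 0

-- type C_n area vector: μ_i = (n+1-i) - λ_{n+1-i}, i.e. the reverse of
-- the list (j - λ_j)_{j = 1..n}
areaC : ℕ → List Step → List ℤ
areaC n π = reverse (zipWith _⊖_ (map suc (upTo n)) (lambdas π))

readPQ : ℤ → ℤ → List ℤ → List Step
readPQ p q [] = []
readPQ p q (x ∷ a) with x ℤ.≟ p | x ℤ.≟ q
... | yes _ | _ = N ∷ readPQ p q a
... | no _ | yes _ = E ∷ readPQ p q a
... | no _ | no _ = readPQ p q a

SfwdPlus : ℕ → List ℤ → List Step
SfwdPlus j a = readPQ (+ j) (+ suc j) a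

SbwdPlus : ℕ → List ℤ → List Step
SbwdPlus j a = readPQ (+ j) (+ suc j) (reverse a)

SfwdMinus : ℕ → List ℤ → List Step
SfwdMinus j a = readPQ (- (+ j)) (- (+ suc j)) a

SbwdMinus : ℕ → List ℤ → List Step
SbwdMinus j a = readPQ (- (+ j)) (- (+ suc j)) (reverse a)

-- S←⁻_j(μ) S→⁺_j(μ) S←⁻_{j-1}(μ) S→⁺_{j-1}(μ) ⋯ S←⁻_0(μ) S→⁺_0(μ)
zetaBlocks : ℕ → List ℤ → List Step
zetaBlocks zero μ = SbwdMinus 0 μ ++ SfwdPlus 0 μ
zetaBlocks (suc j) μ = (SbwdMinus (suc j) μ ++ SfwdPlus (suc j) μ) ++ zetaBlocks j μ

zetaC : ℕ → List Step → List Step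
zetaC n π = zetaBlocks n (areaC n π)

-- Read π as a walk from height 0, North steps going up and East steps going down. Then
-- μ_i = (n+1-i) − λ_{n+1-i} is the height reached by the (n+1-i)-th North step, and the blocks
-- S←⁻_j(μ) S→⁺_j(μ) read the heights −j, −j−1 forwards along the walk and the heights j, j+1
-- backwards. Hence ζ_C(π) is the type A zeta map ζ_A (read levels n, n−1, …, 0 of a word, each
-- left to right, writing N for an entry j and E for j+1) applied to b = F ++ reverse R, where F
-- lists the depths of the heights ≤ 0 and R the heights ≥ 0, in the order the walk reaches them.
--
-- ζ_A is a bijection from words bounded by t whose entries drop by at most one at each step (and
-- end in 0 or 1) onto ballot paths with at most t East steps: ζ_A(t+1, b) = ζ_A(t, b′) ++ (level 0
-- of b), where b′ removes the zeros of b and decrements the rest, and the first factor is the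
-- prefix of the path ending at its k-th North step, k being its number of East steps.
-- Conversely F is the prefix of b holding half of its zeros, and the walk is rebuilt from the
-- recorded heights one North step at a time. Counting zeros of b once and other entries twice
-- counts every North step of π twice, which matches the length 2n of ζ_C(π).

module Submission where

open import Defs
open import Data.Nat using (ℕ; _≤_; _*_)
open import Data.List using (List)
open import Data.Product using (_×_; ∃-syntax)
open import Relation.Binary.PropositionalEquality using (_≡_)

open import Data.Nat using (zero; suc; _+_; _∸_; _<_; pred; z≤n; s≤s)
import Data.Nat.Properties as ℕ
open import Data.List using ([]; _∷_; _++_; [_]; length; take; reverse; reverseAcc; map; replicate; zipWith; applyUpTo)
open import Data.List.Relation.Unary.All using (All; []; _∷_)
import Data.List.Relation.Unary.All as All
import Data.List.Relation.Unary.All.Properties as All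
open import Data.List.Relation.Unary.Linked using (Linked; []; [-]; _∷_)
import Data.List.Relation.Unary.Linked as Linked
open import Data.List.Relation.Binary.Permutation.Propositional using (↭-sym)
open import Data.List.Relation.Binary.Permutation.Propositional.Properties using (↭-reverse; All-resp-↭)
open import Data.Nat.ListAction using (sum)
import Data.Nat.ListAction.Properties as Sum
import Data.List.Properties as List
open import Data.Product using (_,_; proj₁; proj₂)
open import Data.Empty using (⊥; ⊥-elim)
open import Data.Unit using (⊤; tt)
open import Function using (_∘_; flip)
open import Relation.Nullary using (yes; no)
open import Relation.Binary.Definitions using (DecidableEquality)
open import Data.Integer as ℤ using (ℤ; -[1+_]; _⊖_) renaming (+_ to pos)
import Data.Integer.Properties as ℤₚ
open import Relation.Binary.PropositionalEquality using (refl; sym; trans; cong; cong₂; subst; _≢_; module ≡-Reasoning)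

module Occurrences {A : Set} (_≟_ : DecidableEquality A) (a : A) where

  occ : List A → ℕ
  occ [] = 0
  occ (x ∷ l) with x ≟ a
  ... | yes _ = suc (occ l)
  ... | no _ = occ l

  occ-≡ : ∀ {x} → x ≡ a → ∀ l → occ (x ∷ l) ≡ suc (occ l)
  occ-≡ {x} x≡a l with x ≟ a
  ... | yes _ = refl
  ... | no x≢a = ⊥-elim (x≢a x≡a)

  occ-≢ : ∀ {x} → x ≢ a → ∀ l → occ (x ∷ l) ≡ occ l
  occ-≢ {x} x≢a l with x ≟ a
  ... | yes x≡a = ⊥-elim (x≢a x≡a)
  ... | no _ = refl

  occ-++ : ∀ l m → occ (l ++ m) ≡ occ l + occ m
  occ-++ [] m = refl
  occ-++ (x ∷ l) m with x ≟ a
  ... | yes _ = cong suc (occ-++ l m)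
  ... | no _ = occ-++ l m

  occ-reverse : ∀ l → occ (reverse l) ≡ occ l
  occ-reverse [] = refl
  occ-reverse (x ∷ l) = begin
    occ (reverse (x ∷ l))        ≡⟨ cong occ (List.unfold-reverse x l) ⟩
    occ (reverse l ++ [ x ])     ≡⟨ occ-++ (reverse l) [ x ] ⟩
    occ (reverse l) + occ [ x ]  ≡⟨ cong (_+ occ [ x ]) (occ-reverse l) ⟩
    occ l + occ [ x ]            ≡⟨ ℕ.+-comm (occ l) (occ [ x ]) ⟩
    occ [ x ] + occ l            ≡⟨ occ-∷ ⟩
    occ (x ∷ l)                  ∎
    where
    open ≡-Reasoning
    occ-∷ : occ [ x ] + occ l ≡ occ (x ∷ l)
    occ-∷ with x ≟ a
    ... | yes _ = refl
    ... | no _ = refl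

  -- Holds vacuously for [].
  EndsIn : List A → Set
  EndsIn [] = ⊤
  EndsIn (x ∷ []) = x ≡ a
  EndsIn (x ∷ y ∷ l) = EndsIn (y ∷ l)

  endsIn-tail : ∀ x l → EndsIn (x ∷ l) → EndsIn l
  endsIn-tail x [] _ = tt
  endsIn-tail x (y ∷ l) e = e

  endsIn-∷ : ∀ l → EndsIn l → EndsIn (a ∷ l)
  endsIn-∷ [] _ = refl
  endsIn-∷ (y ∷ l) e = e

  endsIn-++ : ∀ x y → y ≢ [] → EndsIn y → EndsIn (x ++ y)
  endsIn-++ [] y _ e = e
  endsIn-++ (z ∷ []) [] y≢[] _ = ⊥-elim (y≢[] refl)
  endsIn-++ (z ∷ []) (w ∷ y) _ e = e
  endsIn-++ (z ∷ z′ ∷ x) y y≢[] e = endsIn-++ (z′ ∷ x) y y≢[] e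

  endsIn-++⁻ʳ : ∀ x y → EndsIn (x ++ y) → EndsIn y
  endsIn-++⁻ʳ [] y e = e
  endsIn-++⁻ʳ (z ∷ x) y e = endsIn-++⁻ʳ x y (endsIn-tail z (x ++ y) e)

  endsIn⇒occ>0 : ∀ x l → EndsIn (x ∷ l) → 1 ≤ occ (x ∷ l)
  endsIn⇒occ>0 x l e with x ≟ a
  ... | yes _ = s≤s z≤n
  endsIn⇒occ>0 x [] refl | no x≢a = ⊥-elim (x≢a refl)
  endsIn⇒occ>0 x (y ∷ l) e | no _ = endsIn⇒occ>0 y l e

  -- The shortest prefix containing k occurrences of a (all of l if there are fewer).
  through : ℕ → List A → List A
  through zero l = []
  through (suc k) [] = []
  through (suc k) (x ∷ l) with x ≟ a
  ... | yes _ = x ∷ through k l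
  ... | no _ = x ∷ through (suc k) l

  after : ℕ → List A → List A
  after zero l = l
  after (suc k) [] = []
  after (suc k) (x ∷ l) with x ≟ a
  ... | yes _ = after k l
  ... | no _ = after (suc k) l

  through-++-after : ∀ k l → through k l ++ after k l ≡ l
  through-++-after zero l = refl
  through-++-after (suc k) [] = refl
  through-++-after (suc k) (x ∷ l) with x ≟ a
  ... | yes _ = cong (x ∷_) (through-++-after k l)
  ... | no _ = cong (x ∷_) (through-++-after (suc k) l)

  occ-through : ∀ k l → k ≤ occ l → occ (through k l) ≡ k
  occ-through zero l _ = refl
  occ-through (suc k) [] ()
  occ-through (suc k) (x ∷ l) k≤ with x ≟ a
  ... | yes x≡a = trans (occ-≡ x≡a (through k l)) (cong suc (occ-through k l (ℕ.≤-pred k≤)))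
  ... | no x≢a = trans (occ-≢ x≢a (through (suc k) l)) (occ-through (suc k) l k≤)

  through-nonempty : ∀ k l → suc k ≤ occ l → through (suc k) l ≢ []
  through-nonempty k [] ()
  through-nonempty k (x ∷ l) _ with x ≟ a
  ... | yes _ = λ ()
  ... | no _ = λ ()

  endsIn-through : ∀ k l → k ≤ occ l → EndsIn (through k l)
  endsIn-through zero l _ = tt
  endsIn-through (suc k) [] ()
  endsIn-through (suc k) (x ∷ l) k≤ with x ≟ a
  endsIn-through (suc zero) (x ∷ l) k≤ | yes x≡a = x≡a
  endsIn-through (suc (suc k)) (x ∷ l) k≤ | yes _ =
    endsIn-++ [ x ] (through (suc k) l) (through-nonempty k l (ℕ.≤-pred k≤))
      (endsIn-through (suc k) l (ℕ.≤-pred k≤))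
  endsIn-through (suc k) (x ∷ l) k≤ | no _ =
    endsIn-++ [ x ] (through (suc k) l) (through-nonempty k l k≤) (endsIn-through (suc k) l k≤)

  through-unique : ∀ x r {k} → EndsIn x → occ x ≡ k → through k (x ++ r) ≡ x
  through-unique [] r e refl = refl
  through-unique (x ∷ l) r {zero} e occ≡0 =
    ⊥-elim (ℕ.<⇒≢ (endsIn⇒occ>0 x l e) (sym occ≡0))
  through-unique (x ∷ l) r {suc k} e occ≡ with x ≟ a
  through-unique (x ∷ []) r {suc .0} e refl | yes _ = refl
  through-unique (x ∷ y ∷ l) r {suc k} e occ≡ | yes _ =
    cong (x ∷_) (through-unique (y ∷ l) r e (ℕ.suc-injective occ≡))
  through-unique (x ∷ []) r {suc k} refl occ≡ | no x≢a = ⊥-elim (x≢a refl)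
  through-unique (x ∷ y ∷ l) r {suc k} e occ≡ | no _ =
    cong (x ∷_) (through-unique (y ∷ l) r e occ≡)

  endsIn-prefix-unique : ∀ x x′ {r r′} → x ++ r ≡ x′ ++ r′ →
                         EndsIn x → EndsIn x′ → occ x ≡ occ x′ → x ≡ x′
  endsIn-prefix-unique x x′ {r} {r′} eq e e′ occ≡ = begin
    x                        ≡⟨ sym (through-unique x r e occ≡) ⟩
    through (occ x′) (x ++ r)  ≡⟨ cong (through (occ x′)) eq ⟩
    through (occ x′) (x′ ++ r′) ≡⟨ through-unique x′ r′ e′ refl ⟩
    x′                       ∎
    where open ≡-Reasoning

module _ {A : Set} {R : A → A → Set} where

  linked-++⁻ˡ : ∀ xs {ys} → Linked R (xs ++ ys) → Linked R xs
  linked-++⁻ˡ [] _ = []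
  linked-++⁻ˡ (x ∷ []) _ = [-]
  linked-++⁻ˡ (x ∷ y ∷ xs) (r ∷ l) = r ∷ linked-++⁻ˡ (y ∷ xs) l

  linked-++⁻ʳ : ∀ xs {ys} → Linked R (xs ++ ys) → Linked R ys
  linked-++⁻ʳ [] l = l
  linked-++⁻ʳ (x ∷ xs) l = linked-++⁻ʳ xs (Linked.tail l)

  linked-reverse : ∀ {xs} → Linked R xs → Linked (flip R) (reverse xs)
  linked-reverse {[]} _ = []
  linked-reverse {x ∷ xs} l = linked-reverseAcc xs [] l [-]
    where
    linked-reverseAcc : ∀ {x} xs acc → Linked R (x ∷ xs) → Linked (flip R) (x ∷ acc) →
                        Linked (flip R) (reverseAcc (x ∷ acc) xs)
    linked-reverseAcc [] acc _ l′ = l′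
    linked-reverseAcc (y ∷ xs) acc (r ∷ l) l′ = linked-reverseAcc xs (_ ∷ acc) l (r ∷ l′)

_≟ₛ_ : DecidableEquality Step
N ≟ₛ N = yes refl
N ≟ₛ E = no λ ()
E ≟ₛ N = no λ ()
E ≟ₛ E = yes refl

countN-++ : ∀ x y → countN (x ++ y) ≡ countN x + countN y
countN-++ [] y = refl
countN-++ (N ∷ x) y = cong suc (countN-++ x y)
countN-++ (E ∷ x) y = countN-++ x y

countE-++ : ∀ x y → countE (x ++ y) ≡ countE x + countE y
countE-++ [] y = refl
countE-++ (N ∷ x) y = countE-++ x y
countE-++ (E ∷ x) y = cong suc (countE-++ x y)

length≡countN+countE : ∀ w → length w ≡ countN w + countE w
length≡countN+countE [] = refl
length≡countN+countE (N ∷ w) = cong suc (length≡countN+countE w)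
length≡countN+countE (E ∷ w) =
  trans (cong suc (length≡countN+countE w)) (sym (ℕ.+-suc (countN w) (countE w)))

module NorthSteps = Occurrences _≟ₛ_ N
module Zeros = Occurrences ℕ._≟_ 0
open Zeros using () renaming (occ to zeros)

countN≡occ : ∀ w → countN w ≡ NorthSteps.occ w
countN≡occ [] = refl
countN≡occ (N ∷ w) = cong suc (countN≡occ w)
countN≡occ (E ∷ w) = countN≡occ w

-- Ballot paths

Ballot : ℕ → List Step → Set
Ballot h [] = ⊤
Ballot h (N ∷ w) = Ballot (suc h) w
Ballot zero (E ∷ w) = ⊥
Ballot (suc h) (E ∷ w) = Ballot h w

countE≤⇒ballot : ∀ h w → countE w ≤ h → Ballot h w
countE≤⇒ballot h [] _ = tt
countE≤⇒ballot h (N ∷ w) le = countE≤⇒ballot (suc h) w (ℕ.m≤n⇒m≤1+n le)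
countE≤⇒ballot (suc h) (E ∷ w) (s≤s le) = countE≤⇒ballot h w le

ballot-++ : ∀ h x y → Ballot h x →
            (∀ m → countE x + m ≡ h + countN x → Ballot m y) → Ballot h (x ++ y)
ballot-++ h [] y _ ballot-y = ballot-y h (sym (ℕ.+-identityʳ h))
ballot-++ h (N ∷ x) y bx ballot-y =
  ballot-++ (suc h) x y bx (λ m eq → ballot-y m (trans eq (sym (ℕ.+-suc h (countN x)))))
ballot-++ (suc h) (E ∷ x) y bx ballot-y = ballot-++ h x y bx (λ m eq → ballot-y m (cong suc eq))

ballot-++⁻ˡ : ∀ h x y → Ballot h (x ++ y) → Ballot h x
ballot-++⁻ˡ h [] y _ = tt
ballot-++⁻ˡ h (N ∷ x) y b = ballot-++⁻ˡ (suc h) x y b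
ballot-++⁻ˡ (suc h) (E ∷ x) y b = ballot-++⁻ˡ h x y b

ballot⇒countE≤ : ∀ h w → Ballot h w → countE w ≤ h + countN w
ballot⇒countE≤ h [] _ = z≤n
ballot⇒countE≤ h (N ∷ w) b =
  ℕ.≤-trans (ballot⇒countE≤ (suc h) w b) (ℕ.≤-reflexive (sym (ℕ.+-suc h (countN w))))
ballot⇒countE≤ (suc h) (E ∷ w) b = s≤s (ballot⇒countE≤ h w b)

ballot⇒take : ∀ h w → Ballot h w → ∀ k → countE (take k w) ≤ h + countN (take k w)
ballot⇒take h w b zero = z≤n
ballot⇒take h [] b (suc k) = z≤n
ballot⇒take h (N ∷ w) b (suc k) =
  ℕ.≤-trans (ballot⇒take (suc h) w b k) (ℕ.≤-reflexive (sym (ℕ.+-suc h (countN (take k w)))))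
ballot⇒take (suc h) (E ∷ w) b (suc k) = s≤s (ballot⇒take h w b k)

take⇒ballot : ∀ h w → (∀ k → countE (take k w) ≤ h + countN (take k w)) → Ballot h w
take⇒ballot h [] _ = tt
take⇒ballot h (N ∷ w) le =
  take⇒ballot (suc h) w λ k → ℕ.≤-trans (le (suc k)) (ℕ.≤-reflexive (ℕ.+-suc h (countN (take k w))))
take⇒ballot zero (E ∷ w) le with le 1
... | ()
take⇒ballot (suc h) (E ∷ w) le = take⇒ballot h w λ k → ℕ.≤-pred (le (suc k))

ballot-endsIn-N⇒countE< : ∀ h x → Ballot h x → NorthSteps.EndsIn x → x ≢ [] →
                           countE x < h + countN x
ballot-endsIn-N⇒countE< h [] _ _ x≢[] = ⊥-elim (x≢[] refl)
ballot-endsIn-N⇒countE< h (.N ∷ []) _ refl _ = ℕ.m≤n+m 1 h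
ballot-endsIn-N⇒countE< h (N ∷ y ∷ x) b e _ =
  ℕ.≤-trans (ballot-endsIn-N⇒countE< (suc h) (y ∷ x) b e λ ())
            (ℕ.≤-reflexive (sym (ℕ.+-suc h (countN (y ∷ x)))))
ballot-endsIn-N⇒countE< (suc h) (E ∷ y ∷ x) b e _ = s≤s (ballot-endsIn-N⇒countE< h (y ∷ x) b e λ ())

-- The type A zeta map

tally : (ℕ → ℕ) → List ℕ → ℕ
tally f b = sum (map f b)

tally-++ : ∀ f b c → tally f (b ++ c) ≡ tally f b + tally f c
tally-++ f b c = trans (cong sum (List.map-++ f b c)) (Sum.sum-++ (map f b) (map f c))

tally-reverse : ∀ f b → tally f (reverse b) ≡ tally f b
tally-reverse f b = trans (cong sum (List.reverse-map f b)) (Sum.sum-↭ (↭-reverse (map f b)))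

positives ones weight : List ℕ → ℕ
positives = tally λ { zero → 0 ; (suc _) → 1 }
ones = tally λ { (suc zero) → 1 ; _ → 0 }
weight = tally λ { zero → 1 ; (suc _) → 2 }

length≡zeros+positives : ∀ b → length b ≡ zeros b + positives b
length≡zeros+positives [] = refl
length≡zeros+positives (zero ∷ b) = cong suc (length≡zeros+positives b)
length≡zeros+positives (suc x ∷ b) =
  trans (cong suc (length≡zeros+positives b)) (sym (ℕ.+-suc (zeros b) (positives b)))

weight≡length+positives : ∀ b → weight b ≡ length b + positives b
weight≡length+positives [] = refl
weight≡length+positives (zero ∷ b) = cong suc (weight≡length+positives b)
weight≡length+positives (suc x ∷ b) =
  cong suc (trans (cong suc (weight≡length+positives b)) (sym (ℕ.+-suc (length b) (positives b))))

letter : ℕ → ℕ → List Step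
letter zero zero = N ∷ []
letter zero (suc zero) = E ∷ []
letter zero (suc (suc _)) = []
letter (suc j) zero = []
letter (suc j) (suc x) = letter j x

readLevel : ℕ → List ℕ → List Step
readLevel j [] = []
readLevel j (x ∷ b) = letter j x ++ readLevel j b

lower : List ℕ → List ℕ
lower [] = []
lower (zero ∷ b) = lower b
lower (suc x ∷ b) = x ∷ lower b

zetaA : ℕ → List ℕ → List Step
zetaA zero b = readLevel 0 b
zetaA (suc t) b = readLevel (suc t) b ++ zetaA t b

readLevel-++ : ∀ j b c → readLevel j (b ++ c) ≡ readLevel j b ++ readLevel j c
readLevel-++ j [] c = refl
readLevel-++ j (x ∷ b) c =
  trans (cong (letter j x ++_) (readLevel-++ j b c)) (sym (List.++-assoc (letter j x) (readLevel j b) (readLevel j c)))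

readLevel-lower : ∀ j b → readLevel (suc j) b ≡ readLevel j (lower b)
readLevel-lower j [] = refl
readLevel-lower j (zero ∷ b) = readLevel-lower j b
readLevel-lower j (suc x ∷ b) = cong (letter j x ++_) (readLevel-lower j b)

zetaA-suc : ∀ t b → zetaA (suc t) b ≡ zetaA t (lower b) ++ readLevel 0 b
zetaA-suc zero b = cong (_++ readLevel 0 b) (readLevel-lower 0 b)
zetaA-suc (suc t) b = begin
  readLevel (suc (suc t)) b ++ zetaA (suc t) b
    ≡⟨ cong₂ _++_ (readLevel-lower (suc t) b) (zetaA-suc t b) ⟩
  readLevel (suc t) (lower b) ++ (zetaA t (lower b) ++ readLevel 0 b)
    ≡⟨ List.++-assoc (readLevel (suc t) (lower b)) (zetaA t (lower b)) (readLevel 0 b) ⟨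
  zetaA (suc t) (lower b) ++ readLevel 0 b ∎
  where open ≡-Reasoning

zetaA-[] : ∀ t → zetaA t [] ≡ []
zetaA-[] zero = refl
zetaA-[] (suc t) = zetaA-[] t

lower-bounded : ∀ t b → All (_≤ suc t) b → All (_≤ t) (lower b)
lower-bounded t [] [] = []
lower-bounded t (zero ∷ b) (_ ∷ bd) = lower-bounded t b bd
lower-bounded t (suc x ∷ b) (s≤s x≤t ∷ bd) = x≤t ∷ lower-bounded t b bd

lower-of-zeros : ∀ b → All (_≤ 0) b → lower b ≡ []
lower-of-zeros [] [] = refl
lower-of-zeros (zero ∷ b) (_ ∷ bd) = lower-of-zeros b bd

ones-of-zeros : ∀ b → All (_≤ 0) b → ones b ≡ 0
ones-of-zeros [] [] = refl
ones-of-zeros (zero ∷ b) (_ ∷ bd) = ones-of-zeros b bd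

length-lower : ∀ b → length (lower b) ≡ positives b
length-lower [] = refl
length-lower (zero ∷ b) = length-lower b
length-lower (suc x ∷ b) = cong suc (length-lower b)

positives-lower : ∀ b → positives (lower b) + ones b ≡ positives b
positives-lower [] = refl
positives-lower (zero ∷ b) = positives-lower b
positives-lower (suc zero ∷ b) = trans (ℕ.+-suc (positives (lower b)) (ones b)) (cong suc (positives-lower b))
positives-lower (suc (suc x) ∷ b) = cong suc (positives-lower b)

countN-readLevel0 : ∀ b → countN (readLevel 0 b) ≡ zeros b
countN-readLevel0 [] = refl
countN-readLevel0 (zero ∷ b) = cong suc (countN-readLevel0 b)
countN-readLevel0 (suc zero ∷ b) = countN-readLevel0 b
countN-readLevel0 (suc (suc x) ∷ b) = countN-readLevel0 b

countE-readLevel0 : ∀ b → countE (readLevel 0 b) ≡ ones b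
countE-readLevel0 [] = refl
countE-readLevel0 (zero ∷ b) = countE-readLevel0 b
countE-readLevel0 (suc zero ∷ b) = cong suc (countE-readLevel0 b)
countE-readLevel0 (suc (suc x) ∷ b) = countE-readLevel0 b

countN-zetaA : ∀ t b → All (_≤ t) b → countN (zetaA t b) ≡ length b
countN-zetaA zero b bd = begin
  countN (readLevel 0 b)  ≡⟨ countN-readLevel0 b ⟩
  zeros b                 ≡⟨ ℕ.+-identityʳ (zeros b) ⟨
  zeros b + 0             ≡⟨ cong (λ c → zeros b + length c) (lower-of-zeros b bd) ⟨
  zeros b + length (lower b) ≡⟨ cong (zeros b +_) (length-lower b) ⟩
  zeros b + positives b   ≡⟨ length≡zeros+positives b ⟨
  length b                ∎
  where open ≡-Reasoning
countN-zetaA (suc t) b bd = begin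
  countN (zetaA (suc t) b)                                   ≡⟨ cong countN (zetaA-suc t b) ⟩
  countN (zetaA t (lower b) ++ readLevel 0 b)                ≡⟨ countN-++ (zetaA t (lower b)) (readLevel 0 b) ⟩
  countN (zetaA t (lower b)) + countN (readLevel 0 b)        ≡⟨ cong₂ _+_ (countN-zetaA t (lower b) (lower-bounded t b bd))
                                                                            (countN-readLevel0 b) ⟩
  length (lower b) + zeros b                                 ≡⟨ cong (_+ zeros b) (length-lower b) ⟩
  positives b + zeros b                                      ≡⟨ ℕ.+-comm (positives b) (zeros b) ⟩
  zeros b + positives b                                      ≡⟨ length≡zeros+positives b ⟨
  length b                                                   ∎
  where open ≡-Reasoning

countE-zetaA : ∀ t b → All (_≤ t) b → countE (zetaA t b) ≡ positives b
countE-zetaA zero b bd = begin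
  countE (readLevel 0 b)          ≡⟨ countE-readLevel0 b ⟩
  ones b                          ≡⟨ cong (λ c → positives c + ones b) (lower-of-zeros b bd) ⟨
  positives (lower b) + ones b    ≡⟨ positives-lower b ⟩
  positives b                     ∎
  where open ≡-Reasoning
countE-zetaA (suc t) b bd = begin
  countE (zetaA (suc t) b)                             ≡⟨ cong countE (zetaA-suc t b) ⟩
  countE (zetaA t (lower b) ++ readLevel 0 b)          ≡⟨ countE-++ (zetaA t (lower b)) (readLevel 0 b) ⟩
  countE (zetaA t (lower b)) + countE (readLevel 0 b)  ≡⟨ cong₂ _+_ (countE-zetaA t (lower b) (lower-bounded t b bd))
                                                                    (countE-readLevel0 b) ⟩
  positives (lower b) + ones b                         ≡⟨ positives-lower b ⟩
  positives b                                          ∎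
  where open ≡-Reasoning

length-zetaA : ∀ t b → All (_≤ t) b → length (zetaA t b) ≡ weight b
length-zetaA t b bd = begin
  length (zetaA t b)                          ≡⟨ length≡countN+countE (zetaA t b) ⟩
  countN (zetaA t b) + countE (zetaA t b)     ≡⟨ cong₂ _+_ (countN-zetaA t b bd) (countE-zetaA t b bd) ⟩
  length b + positives b                      ≡⟨ weight≡length+positives b ⟨
  weight b                                    ∎
  where open ≡-Reasoning

-- zetaA t (lower b) ends at height ones b, the number of East steps of readLevel 0 b.
zetaA-ballot : ∀ t b → All (_≤ t) b → Ballot 0 (zetaA t b)
zetaA-ballot zero b bd =
  countE≤⇒ballot 0 (readLevel 0 b) (ℕ.≤-reflexive (trans (countE-readLevel0 b) (ones-of-zeros b bd)))
zetaA-ballot (suc t) b bd = subst (Ballot 0) (sym (zetaA-suc t b))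
  (ballot-++ 0 (zetaA t b′) (readLevel 0 b) (zetaA-ballot t b′ bd′) λ m eq →
    countE≤⇒ballot m (readLevel 0 b) (ℕ.≤-reflexive (ones≡height m eq)))
  where
  b′ : List ℕ
  b′ = lower b
  bd′ : All (_≤ t) b′
  bd′ = lower-bounded t b bd
  ones≡height : ∀ m → countE (zetaA t b′) + m ≡ countN (zetaA t b′) → countE (readLevel 0 b) ≡ m
  ones≡height m eq = trans (countE-readLevel0 b) (ℕ.+-cancelˡ-≡ (positives b′) (ones b) m (begin
    positives b′ + ones b              ≡⟨ positives-lower b ⟩
    positives b                        ≡⟨ length-lower b ⟨
    length b′                          ≡⟨ countN-zetaA t b′ bd′ ⟨
    countN (zetaA t b′)                ≡⟨ eq ⟨
    countE (zetaA t b′) + m            ≡⟨ cong (_+ m) (countE-zetaA t b′ bd′) ⟩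
    positives b′ + m                   ∎))
    where open ≡-Reasoning

-- Inverting the type A zeta map

Fall≤1 : ℕ → ℕ → Set
Fall≤1 x y = pred x ≤ y

-- The appended 0 bounds the last entry by 1.
Admissible : List ℕ → Set
Admissible b = Linked Fall≤1 (b ++ [ 0 ])

-- Inverse of b ↦ (lower b , readLevel 0 b) on admissible b: there a 0 never directly follows
-- an entry ≥ 2, so the 0s of b (the N's of readLevel 0 b) can be placed as early as possible.
-- Only the case zeros c ≡ countE r matters.
rebuild : List ℕ → List Step → List ℕ
rebuild c (N ∷ r) = 0 ∷ rebuild c r
rebuild (zero ∷ c) (E ∷ r) = 1 ∷ rebuild c r
rebuild (suc x ∷ c) (E ∷ r) = suc (suc x) ∷ rebuild c (E ∷ r)
rebuild (x ∷ c) [] = suc x ∷ rebuild c []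
rebuild [] _ = []

lower-rebuild : ∀ c r → zeros c ≡ countE r → lower (rebuild c r) ≡ c
lower-rebuild c (N ∷ r) eq = lower-rebuild c r eq
lower-rebuild (zero ∷ c) (E ∷ r) eq = cong (0 ∷_) (lower-rebuild c r (ℕ.suc-injective eq))
lower-rebuild (suc x ∷ c) (E ∷ r) eq = cong (suc x ∷_) (lower-rebuild c (E ∷ r) eq)
lower-rebuild (zero ∷ c) [] ()
lower-rebuild (suc x ∷ c) [] eq = cong (suc x ∷_) (lower-rebuild c [] eq)
lower-rebuild [] (E ∷ r) ()
lower-rebuild [] [] eq = refl

readLevel0-rebuild : ∀ c r → zeros c ≡ countE r → readLevel 0 (rebuild c r) ≡ r
readLevel0-rebuild c (N ∷ r) eq = cong (N ∷_) (readLevel0-rebuild c r eq)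
readLevel0-rebuild (zero ∷ c) (E ∷ r) eq = cong (E ∷_) (readLevel0-rebuild c r (ℕ.suc-injective eq))
readLevel0-rebuild (suc x ∷ c) (E ∷ r) eq = readLevel0-rebuild c (E ∷ r) eq
readLevel0-rebuild (zero ∷ c) [] ()
readLevel0-rebuild (suc x ∷ c) [] eq = readLevel0-rebuild c [] eq
readLevel0-rebuild [] (E ∷ r) ()
readLevel0-rebuild [] [] eq = refl

rebuild-bounded : ∀ t c r → All (_≤ t) c → All (_≤ suc t) (rebuild c r)
rebuild-bounded t c (N ∷ r) bd = z≤n ∷ rebuild-bounded t c r bd
rebuild-bounded t (zero ∷ c) (E ∷ r) (_ ∷ bd) = s≤s z≤n ∷ rebuild-bounded t c r bd
rebuild-bounded t (suc x ∷ c) (E ∷ r) (x≤t ∷ bd) = s≤s x≤t ∷ rebuild-bounded t c (E ∷ r) bd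
rebuild-bounded t (x ∷ c) [] (x≤t ∷ bd) = s≤s x≤t ∷ rebuild-bounded t c [] bd
rebuild-bounded t [] (E ∷ r) [] = []
rebuild-bounded t [] [] [] = []

rebuild-[]-bounded : ∀ r → All (_≤ 0) (rebuild [] r)
rebuild-[]-bounded (N ∷ r) = z≤n ∷ rebuild-[]-bounded r
rebuild-[]-bounded (E ∷ r) = []
rebuild-[]-bounded [] = []

fall-∷ : ∀ {x Y} → x ≤ 1 → Linked Fall≤1 Y → Linked Fall≤1 (x ∷ Y)
fall-∷ {Y = []} _ _ = [-]
fall-∷ {zero} {y ∷ Y} _ l = z≤n ∷ l
fall-∷ {suc zero} {y ∷ Y} _ l = z≤n ∷ l
fall-∷ {suc (suc _)} {y ∷ Y} (s≤s ()) _

admissible-rebuild : ∀ c r → Admissible c → Zeros.EndsIn c → zeros c ≡ countE r →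
                     Admissible (rebuild c r)
admissible-rebuild c (N ∷ r) l e eq = fall-∷ z≤n (admissible-rebuild c r l e eq)
admissible-rebuild (zero ∷ c) (E ∷ r) l e eq =
  fall-∷ (s≤s z≤n) (admissible-rebuild c r (Linked.tail l) (Zeros.endsIn-tail 0 c e) (ℕ.suc-injective eq))
admissible-rebuild (suc x ∷ []) r _ () _
admissible-rebuild (suc x ∷ zero ∷ c) (E ∷ r) (x≤0 ∷ l) e eq = s≤s x≤0 ∷ admissible-rebuild (zero ∷ c) (E ∷ r) l e eq
admissible-rebuild (suc x ∷ suc y ∷ c) (E ∷ r) (x≤y ∷ l) e eq = s≤s x≤y ∷ admissible-rebuild (suc y ∷ c) (E ∷ r) l e eq
admissible-rebuild (suc x ∷ suc y ∷ c) [] (x≤y ∷ l) e eq = s≤s x≤y ∷ admissible-rebuild (suc y ∷ c) [] l e eq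
admissible-rebuild (zero ∷ c) [] _ _ ()
admissible-rebuild (suc x ∷ zero ∷ c) [] _ _ ()
admissible-rebuild [] (E ∷ r) _ _ ()
admissible-rebuild [] [] _ _ _ = [-]

rebuild-nonempty : ∀ c r → zeros c ≡ countE r → r ≢ [] → rebuild c r ≢ []
rebuild-nonempty c (N ∷ r) _ _ ()
rebuild-nonempty (zero ∷ c) (E ∷ r) _ _ ()
rebuild-nonempty (suc x ∷ c) (E ∷ r) _ _ ()
rebuild-nonempty [] (E ∷ r) () _
rebuild-nonempty c [] _ r≢[] = ⊥-elim (r≢[] refl)

rebuild-∷-nonempty : ∀ y c r → rebuild (y ∷ c) r ≢ []
rebuild-∷-nonempty y c (N ∷ r) ()
rebuild-∷-nonempty zero c (E ∷ r) ()
rebuild-∷-nonempty (suc y) c (E ∷ r) ()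
rebuild-∷-nonempty y c [] ()

endsIn-rebuild : ∀ c r → Zeros.EndsIn c → zeros c ≡ countE r → NorthSteps.EndsIn r →
                 Zeros.EndsIn (rebuild c r)
endsIn-rebuild c (N ∷ r) ec eq er =
  Zeros.endsIn-∷ (rebuild c r) (endsIn-rebuild c r ec eq (NorthSteps.endsIn-tail N r er))
endsIn-rebuild (zero ∷ c) (E ∷ []) _ _ ()
endsIn-rebuild (zero ∷ c) (E ∷ s ∷ r) ec eq er =
  Zeros.endsIn-++ [ 1 ] (rebuild c (s ∷ r)) (rebuild-nonempty c (s ∷ r) (ℕ.suc-injective eq) λ ())
    (endsIn-rebuild c (s ∷ r) (Zeros.endsIn-tail 0 c ec) (ℕ.suc-injective eq) er)
endsIn-rebuild (suc x ∷ []) _ () _ _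
endsIn-rebuild (suc x ∷ y ∷ c) (E ∷ r) ec eq er =
  Zeros.endsIn-++ [ suc (suc x) ] _ (rebuild-∷-nonempty y c (E ∷ r)) (endsIn-rebuild (y ∷ c) (E ∷ r) ec eq er)
endsIn-rebuild (suc x ∷ y ∷ c) [] ec eq er =
  Zeros.endsIn-++ [ suc (suc x) ] _ (rebuild-∷-nonempty y c []) (endsIn-rebuild (y ∷ c) [] ec eq er)
endsIn-rebuild (zero ∷ c) [] _ () _
endsIn-rebuild [] (E ∷ r) _ () _
endsIn-rebuild [] [] _ _ _ = tt

rebuild-after-≥2 : ∀ x c y b → Linked Fall≤1 (suc (suc y) ∷ b ++ [ 0 ]) →
                   rebuild (suc x ∷ c) (readLevel 0 b) ≡ suc (suc x) ∷ rebuild c (readLevel 0 b)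
rebuild-after-≥2 x c y [] _ = refl
rebuild-after-≥2 x c y (zero ∷ b) (() ∷ _)
rebuild-after-≥2 x c y (suc zero ∷ b) _ = refl
rebuild-after-≥2 x c y (suc (suc z) ∷ b) (_ ∷ l) = rebuild-after-≥2 x c z b l

rebuild-lower : ∀ b → Admissible b → rebuild (lower b) (readLevel 0 b) ≡ b
rebuild-lower [] _ = refl
rebuild-lower (zero ∷ b) l = cong (0 ∷_) (rebuild-lower b (Linked.tail l))
rebuild-lower (suc zero ∷ b) l = cong (1 ∷_) (rebuild-lower b (Linked.tail l))
rebuild-lower (suc (suc x) ∷ b) l =
  trans (rebuild-after-≥2 x (lower b) x b l) (cong (suc (suc x) ∷_) (rebuild-lower b (Linked.tail l)))

endsIn-lower : ∀ b → Admissible b → Zeros.EndsIn (lower b)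
endsIn-lower [] _ = tt
endsIn-lower (zero ∷ b) l = endsIn-lower b (Linked.tail l)
endsIn-lower (suc x ∷ []) (x≤0 ∷ _) = ℕ.n≤0⇒n≡0 x≤0
endsIn-lower (suc zero ∷ zero ∷ b) (_ ∷ l) = Zeros.endsIn-∷ (lower b) (endsIn-lower (zero ∷ b) l)
endsIn-lower (suc (suc x) ∷ zero ∷ b) (() ∷ _)
endsIn-lower (suc x ∷ suc y ∷ b) (_ ∷ l) = endsIn-lower (suc y ∷ b) l

admissible-lower : ∀ b → Admissible b → Admissible (lower b)
admissible-lower [] _ = [-]
admissible-lower (zero ∷ b) l = admissible-lower b (Linked.tail l)
admissible-lower (suc x ∷ []) (x≤0 ∷ _) = ℕ.≤-trans (ℕ.pred-mono-≤ x≤0) z≤n ∷ [-]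
admissible-lower (suc zero ∷ zero ∷ b) (_ ∷ l) = fall-∷ z≤n (admissible-lower (zero ∷ b) l)
admissible-lower (suc (suc x) ∷ zero ∷ b) (() ∷ _)
admissible-lower (suc x ∷ suc y ∷ b) (x≤y ∷ l) = ℕ.pred-mono-≤ x≤y ∷ admissible-lower (suc y ∷ b) l

endsIn-readLevel0 : ∀ y b → Zeros.EndsIn (y ∷ b) →
                    NorthSteps.EndsIn (readLevel 0 (y ∷ b)) × readLevel 0 (y ∷ b) ≢ []
endsIn-readLevel0 .0 [] refl = refl , λ ()
endsIn-readLevel0 y (z ∷ b) e with endsIn-readLevel0 z b e
... | ends , nonempty =
  NorthSteps.endsIn-++ (letter 0 y) (readLevel 0 (z ∷ b)) nonempty ends ,
  λ eq → nonempty (List.++-conicalʳ (letter 0 y) (readLevel 0 (z ∷ b)) eq)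

endsIn-zetaA : ∀ t b → Zeros.EndsIn b → NorthSteps.EndsIn (zetaA t b)
endsIn-zetaA t [] _ = subst NorthSteps.EndsIn (sym (zetaA-[] t)) tt
endsIn-zetaA zero (y ∷ b) e = proj₁ (endsIn-readLevel0 y b e)
endsIn-zetaA (suc t) (y ∷ b) e = subst NorthSteps.EndsIn (sym (zetaA-suc t (y ∷ b)))
  (NorthSteps.endsIn-++ (zetaA t (lower (y ∷ b))) _ (proj₂ (endsIn-readLevel0 y b e)) (proj₁ (endsIn-readLevel0 y b e)))

admissible-determined : ∀ b c → Admissible b → Admissible c →
                        lower b ≡ lower c → readLevel 0 b ≡ readLevel 0 c → b ≡ c
admissible-determined b c ab ac lower≡ level0≡ = begin
  b                                  ≡⟨ rebuild-lower b ab ⟨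
  rebuild (lower b) (readLevel 0 b)  ≡⟨ cong₂ rebuild lower≡ level0≡ ⟩
  rebuild (lower c) (readLevel 0 c)  ≡⟨ rebuild-lower c ac ⟩
  c                                  ∎
  where open ≡-Reasoning

countN-zetaA-lower : ∀ t b → All (_≤ suc t) b → countN (zetaA t (lower b)) ≡ countE (zetaA (suc t) b)
countN-zetaA-lower t b bd = begin
  countN (zetaA t (lower b))  ≡⟨ countN-zetaA t (lower b) (lower-bounded t b bd) ⟩
  length (lower b)            ≡⟨ length-lower b ⟩
  positives b                 ≡⟨ countE-zetaA (suc t) b bd ⟨
  countE (zetaA (suc t) b)    ∎
  where open ≡-Reasoning

-- zetaA (suc t) b splits uniquely as zetaA t (lower b) ++ readLevel 0 b: the first part
-- ends in N and its number of N's is the number of E's of the whole word.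
zetaA-injective : ∀ t b c → Admissible b → Admissible c → All (_≤ t) b → All (_≤ t) c →
                  zetaA t b ≡ zetaA t c → b ≡ c
zetaA-injective zero b c ab ac bb bc eq =
  admissible-determined b c ab ac (trans (lower-of-zeros b bb) (sym (lower-of-zeros c bc))) eq
zetaA-injective (suc t) b c ab ac bb bc eq =
  admissible-determined b c ab ac
    (zetaA-injective t (lower b) (lower c) (admissible-lower b ab) (admissible-lower c ac)
      (lower-bounded t b bb) (lower-bounded t c bc) upper≡)
    level0≡
  where
  split≡ : zetaA t (lower b) ++ readLevel 0 b ≡ zetaA t (lower c) ++ readLevel 0 c
  split≡ = trans (sym (zetaA-suc t b)) (trans eq (zetaA-suc t c))
  northSteps≡ : NorthSteps.occ (zetaA t (lower b)) ≡ NorthSteps.occ (zetaA t (lower c))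
  northSteps≡ = begin
    NorthSteps.occ (zetaA t (lower b))  ≡⟨ countN≡occ (zetaA t (lower b)) ⟨
    countN (zetaA t (lower b))          ≡⟨ countN-zetaA-lower t b bb ⟩
    countE (zetaA (suc t) b)            ≡⟨ cong countE eq ⟩
    countE (zetaA (suc t) c)            ≡⟨ countN-zetaA-lower t c bc ⟨
    countN (zetaA t (lower c))          ≡⟨ countN≡occ (zetaA t (lower c)) ⟩
    NorthSteps.occ (zetaA t (lower c))  ∎
    where open ≡-Reasoning
  upper≡ : zetaA t (lower b) ≡ zetaA t (lower c)
  upper≡ = NorthSteps.endsIn-prefix-unique _ _ split≡
    (endsIn-zetaA t (lower b) (endsIn-lower b ab)) (endsIn-zetaA t (lower c) (endsIn-lower c ac)) northSteps≡
  level0≡ : readLevel 0 b ≡ readLevel 0 c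
  level0≡ = List.++-cancelˡ (zetaA t (lower b)) (readLevel 0 b) (readLevel 0 c)
    (trans split≡ (cong (_++ readLevel 0 c) (sym upper≡)))

record ZetaAPreimage (t : ℕ) (w : List Step) : Set where
  field
    area : List ℕ
    admissible : Admissible area
    bounded : All (_≤ t) area
    zetaA-area : zetaA t area ≡ w
    endsIn-area : NorthSteps.EndsIn w → Zeros.EndsIn area

ballot-endsIn-N⇒countE≤ : ∀ t x → Ballot 0 x → NorthSteps.EndsIn x → countN x ≤ suc t → countE x ≤ t
ballot-endsIn-N⇒countE≤ t [] _ _ _ = z≤n
ballot-endsIn-N⇒countE≤ t (s ∷ x) b e le = ℕ.≤-pred (ℕ.≤-trans (ballot-endsIn-N⇒countE< 0 (s ∷ x) b e λ ()) le)

-- For t + 1, w splits after its (countE w)-th N into zetaA t (lower b) and readLevel 0 b.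
zetaA-surjective : ∀ t w → Ballot 0 w → countE w ≤ t → ZetaAPreimage t w
zetaA-surjective zero w _ ce = record
  { area = rebuild [] w
  ; admissible = admissible-rebuild [] w [-] tt countE≡0
  ; bounded = rebuild-[]-bounded w
  ; zetaA-area = readLevel0-rebuild [] w countE≡0
  ; endsIn-area = endsIn-rebuild [] w tt countE≡0
  }
  where
  countE≡0 : 0 ≡ countE w
  countE≡0 = sym (ℕ.n≤0⇒n≡0 ce)
zetaA-surjective (suc t) w bw ce = record
  { area = rebuild b′ r
  ; admissible = admissible-rebuild b′ r admissible′ (endsIn′ ends-x) zeros≡
  ; bounded = rebuild-bounded t b′ r bounded′
  ; zetaA-area = begin
      zetaA (suc t) (rebuild b′ r)                                     ≡⟨ zetaA-suc t (rebuild b′ r) ⟩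
      zetaA t (lower (rebuild b′ r)) ++ readLevel 0 (rebuild b′ r)     ≡⟨ cong₂ (λ c s → zetaA t c ++ s)
                                                                            (lower-rebuild b′ r zeros≡)
                                                                            (readLevel0-rebuild b′ r zeros≡) ⟩
      zetaA t b′ ++ r                                                  ≡⟨ cong (_++ r) zetaA-b′ ⟩
      x ++ r                                                           ≡⟨ x++r≡w ⟩
      w                                                                ∎
  ; endsIn-area = λ ends-w → endsIn-rebuild b′ r (endsIn′ ends-x) zeros≡
      (NorthSteps.endsIn-++⁻ʳ x r (subst NorthSteps.EndsIn (sym x++r≡w) ends-w))
  }
  where
  open ≡-Reasoning
  K : ℕ
  K = countE w
  x r : List Step
  x = NorthSteps.through K w
  r = NorthSteps.after K w
  x++r≡w : x ++ r ≡ w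
  x++r≡w = NorthSteps.through-++-after K w
  K≤ : K ≤ NorthSteps.occ w
  K≤ = subst (K ≤_) (countN≡occ w) (ballot⇒countE≤ 0 w bw)
  ends-x : NorthSteps.EndsIn x
  ends-x = NorthSteps.endsIn-through K w K≤
  countN-x : countN x ≡ K
  countN-x = trans (countN≡occ x) (NorthSteps.occ-through K w K≤)
  ballot-x : Ballot 0 x
  ballot-x = ballot-++⁻ˡ 0 x r (subst (Ballot 0) (sym x++r≡w) bw)
  open ZetaAPreimage (zetaA-surjective t x ballot-x
         (ballot-endsIn-N⇒countE≤ t x ballot-x ends-x (subst (_≤ suc t) (sym countN-x) ce)))
    renaming (area to b′; admissible to admissible′; bounded to bounded′;
              zetaA-area to zetaA-b′; endsIn-area to endsIn′)
  zeros≡ : zeros b′ ≡ countE r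
  zeros≡ = ℕ.+-cancelʳ-≡ (positives b′) (zeros b′) (countE r) (begin
    zeros b′ + positives b′  ≡⟨ length≡zeros+positives b′ ⟨
    length b′                ≡⟨ countN-zetaA t b′ bounded′ ⟨
    countN (zetaA t b′)      ≡⟨ cong countN zetaA-b′ ⟩
    countN x                 ≡⟨ countN-x ⟩
    countE w                 ≡⟨ cong countE x++r≡w ⟨
    countE (x ++ r)          ≡⟨ countE-++ x r ⟩
    countE x + countE r      ≡⟨ cong (λ v → countE v + countE r) zetaA-b′ ⟨
    countE (zetaA t b′) + countE r  ≡⟨ cong (_+ countE r) (countE-zetaA t b′ bounded′) ⟩
    positives b′ + countE r  ≡⟨ ℕ.+-comm (positives b′) (countE r) ⟩
    countE r + positives b′  ∎)

-- Heights of a path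

heights : ℤ → List Step → List ℤ
heights h [] = []
heights h (N ∷ p) = ℤ.suc h ∷ heights (ℤ.suc h) p
heights h (E ∷ p) = heights (ℤ.pred h) p

final : ℤ → List Step → ℤ
final h [] = h
final h (N ∷ p) = final (ℤ.suc h) p
final h (E ∷ p) = final (ℤ.pred h) p

-- A height 0 enters both lists.
nonpos nonneg : List ℤ → List ℕ
nonpos [] = []
nonpos (pos zero ∷ l) = 0 ∷ nonpos l
nonpos (pos (suc _) ∷ l) = nonpos l
nonpos (-[1+ k ] ∷ l) = suc k ∷ nonpos l
nonneg [] = []
nonneg (pos k ∷ l) = k ∷ nonneg l
nonneg (-[1+ _ ] ∷ l) = nonneg l

below above : ℤ → List Step → List ℕ
below h p = nonpos (heights h p)
above h p = nonneg (heights h p)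

negPart posPart : ℤ → ℕ
negPart (pos _) = 0
negPart -[1+ k ] = suc k
posPart (pos k) = k
posPart -[1+ _ ] = 0

Rise≤1 : ℕ → ℕ → Set
Rise≤1 x y = y ≤ suc x

-- Vacuous for [].
StartsWith0 : List ℕ → Set
StartsWith0 [] = ⊤
StartsWith0 (x ∷ _) = x ≡ 0

negPart≤negPart-pred : ∀ h → negPart h ≤ negPart (ℤ.pred h)
negPart≤negPart-pred (pos zero) = z≤n
negPart≤negPart-pred (pos (suc k)) = z≤n
negPart≤negPart-pred -[1+ k ] = ℕ.n≤1+n _

negPart-pred≤ : ∀ h → negPart (ℤ.pred h) ≤ suc (negPart h)
negPart-pred≤ (pos zero) = ℕ.≤-refl
negPart-pred≤ (pos (suc k)) = z≤n
negPart-pred≤ -[1+ k ] = ℕ.≤-refl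

posPart-pred≤ : ∀ h → posPart (ℤ.pred h) ≤ posPart h
posPart-pred≤ (pos zero) = z≤n
posPart-pred≤ (pos (suc k)) = ℕ.n≤1+n _
posPart-pred≤ -[1+ k ] = z≤n

fall-head-≤ : ∀ {a b l} → a ≤ b → Linked Fall≤1 (b ∷ l) → Linked Fall≤1 (a ∷ l)
fall-head-≤ _ [-] = [-]
fall-head-≤ a≤b (b↘ ∷ l) = ℕ.≤-trans (ℕ.pred-mono-≤ a≤b) b↘ ∷ l

rise-head-≥ : ∀ {a b l} → a ≤ b → Linked Rise≤1 (a ∷ l) → Linked Rise≤1 (b ∷ l)
rise-head-≥ _ [-] = [-]
rise-head-≥ a≤b (a↗ ∷ l) = ℕ.≤-trans a↗ (s≤s a≤b) ∷ l

below-falls : ∀ h p → Linked Fall≤1 (negPart h ∷ below h p)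
below-falls h [] = [-]
below-falls h (E ∷ p) = fall-head-≤ (negPart≤negPart-pred h) (below-falls (ℤ.pred h) p)
below-falls (pos k) (N ∷ p) = below-falls (pos (suc k)) p
below-falls -[1+ zero ] (N ∷ p) = z≤n ∷ below-falls (pos 0) p
below-falls -[1+ suc k ] (N ∷ p) = ℕ.≤-refl ∷ below-falls -[1+ k ] p

above-rises : ∀ h p → Linked Rise≤1 (posPart h ∷ above h p)
above-rises h [] = [-]
above-rises h (E ∷ p) = rise-head-≥ (posPart-pred≤ h) (above-rises (ℤ.pred h) p)
above-rises (pos k) (N ∷ p) = ℕ.≤-refl ∷ above-rises (pos (suc k)) p
above-rises -[1+ zero ] (N ∷ p) = z≤n ∷ above-rises (pos 0) p
above-rises -[1+ suc k ] (N ∷ p) = above-rises -[1+ k ] p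

above-from-negative : ∀ k p → StartsWith0 (above -[1+ k ] p)
above-from-negative k [] = tt
above-from-negative k (E ∷ p) = above-from-negative (suc k) p
above-from-negative zero (N ∷ p) = refl
above-from-negative (suc k) (N ∷ p) = above-from-negative k p

zeros-below≡zeros-above : ∀ h p → zeros (below h p) ≡ zeros (above h p)
zeros-below≡zeros-above h [] = refl
zeros-below≡zeros-above h (E ∷ p) = zeros-below≡zeros-above (ℤ.pred h) p
zeros-below≡zeros-above (pos k) (N ∷ p) = zeros-below≡zeros-above (pos (suc k)) p
zeros-below≡zeros-above -[1+ zero ] (N ∷ p) = cong suc (zeros-below≡zeros-above (pos 0) p)
zeros-below≡zeros-above -[1+ suc k ] (N ∷ p) = zeros-below≡zeros-above -[1+ k ] p

two-more : ∀ {a m} → a ≡ m + m → suc a ≡ m + suc m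
two-more {m = m} eq = trans (cong suc eq) (sym (ℕ.+-suc m m))

-- A recorded height 0 enters both lists and counts 1 in each, any other height enters one
-- list and counts 2: every North step contributes 2 in total.
weight-below+above : ∀ h p → weight (below h p) + weight (above h p) ≡ countN p + countN p
weight-below+above h [] = refl
weight-below+above h (E ∷ p) = weight-below+above (ℤ.pred h) p
weight-below+above (pos k) (N ∷ p) =
  trans (ℕ.+-suc (weight (below h′ p)) (suc (weight (above h′ p))))
    (cong suc (trans (ℕ.+-suc (weight (below h′ p)) (weight (above h′ p))) (two-more (weight-below+above h′ p))))
  where
  h′ : ℤ
  h′ = pos (suc k)
weight-below+above -[1+ zero ] (N ∷ p) =
  cong suc (trans (ℕ.+-suc (weight (below (pos 0) p)) (weight (above (pos 0) p)))
                  (two-more (weight-below+above (pos 0) p)))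
weight-below+above -[1+ suc k ] (N ∷ p) = cong suc (two-more (weight-below+above -[1+ k ] p))

final≡0⇒balanced : ∀ h p → final h p ≡ pos 0 → posPart h + countN p ≡ negPart h + countE p
final≡0⇒balanced (pos .0) [] refl = refl
final≡0⇒balanced -[1+ k ] [] ()
final≡0⇒balanced (pos k) (N ∷ p) eq = trans (ℕ.+-suc k (countN p)) (final≡0⇒balanced (pos (suc k)) p eq)
final≡0⇒balanced -[1+ zero ] (N ∷ p) eq = cong suc (final≡0⇒balanced (pos 0) p eq)
final≡0⇒balanced -[1+ suc k ] (N ∷ p) eq = cong suc (final≡0⇒balanced -[1+ k ] p eq)
final≡0⇒balanced (pos zero) (E ∷ p) eq = final≡0⇒balanced -[1+ 0 ] p eq
final≡0⇒balanced (pos (suc k)) (E ∷ p) eq = cong suc (final≡0⇒balanced (pos k) p eq)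
final≡0⇒balanced -[1+ k ] (E ∷ p) eq =
  trans (final≡0⇒balanced -[1+ suc k ] p eq) (cong suc (sym (ℕ.+-suc k (countE p))))

balanced⇒final≡0 : ∀ h p → posPart h + countN p ≡ negPart h + countE p → final h p ≡ pos 0
balanced⇒final≡0 (pos k) [] eq = cong pos (trans (sym (ℕ.+-identityʳ k)) eq)
balanced⇒final≡0 -[1+ k ] [] ()
balanced⇒final≡0 (pos k) (N ∷ p) eq = balanced⇒final≡0 (pos (suc k)) p (trans (sym (ℕ.+-suc k (countN p))) eq)
balanced⇒final≡0 -[1+ zero ] (N ∷ p) eq = balanced⇒final≡0 (pos 0) p (ℕ.suc-injective eq)
balanced⇒final≡0 -[1+ suc k ] (N ∷ p) eq = balanced⇒final≡0 -[1+ k ] p (ℕ.suc-injective eq)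
balanced⇒final≡0 (pos zero) (E ∷ p) eq = balanced⇒final≡0 -[1+ 0 ] p eq
balanced⇒final≡0 (pos (suc k)) (E ∷ p) eq = balanced⇒final≡0 (pos k) p (ℕ.suc-injective eq)
balanced⇒final≡0 -[1+ k ] (E ∷ p) eq =
  balanced⇒final≡0 -[1+ suc k ] p (trans eq (cong suc (ℕ.+-suc k (countE p))))

below-nonempty : ∀ k p → final -[1+ k ] p ≡ pos 0 → below -[1+ k ] p ≢ []
below-nonempty k [] ()
below-nonempty k (E ∷ p) eq = below-nonempty (suc k) p eq
below-nonempty zero (N ∷ p) _ ()
below-nonempty (suc k) (N ∷ p) _ ()

endsIn-below : ∀ h p → final h p ≡ pos 0 → Zeros.EndsIn (below h p)
endsIn-below h [] _ = tt
endsIn-below h (E ∷ p) eq = endsIn-below (ℤ.pred h) p eq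
endsIn-below (pos k) (N ∷ p) eq = endsIn-below (pos (suc k)) p eq
endsIn-below -[1+ zero ] (N ∷ p) eq = Zeros.endsIn-∷ (below (pos 0) p) (endsIn-below (pos 0) p eq)
endsIn-below -[1+ suc k ] (N ∷ p) eq =
  Zeros.endsIn-++ [ suc k ] (below -[1+ k ] p) (below-nonempty k p eq) (endsIn-below -[1+ k ] p eq)

below-bounded : ∀ h p → All (_≤ negPart h + countE p) (below h p)
below-bounded h [] = []
below-bounded h (E ∷ p) = All.map (λ le → ℕ.≤-trans le bound) (below-bounded (ℤ.pred h) p)
  where
  bound : negPart (ℤ.pred h) + countE p ≤ negPart h + suc (countE p)
  bound = ℕ.≤-trans (ℕ.+-monoˡ-≤ (countE p) (negPart-pred≤ h)) (ℕ.≤-reflexive (sym (ℕ.+-suc (negPart h) (countE p))))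
below-bounded (pos k) (N ∷ p) = below-bounded (pos (suc k)) p
below-bounded -[1+ zero ] (N ∷ p) = z≤n ∷ All.map ℕ.m≤n⇒m≤1+n (below-bounded (pos 0) p)
below-bounded -[1+ suc k ] (N ∷ p) =
  ℕ.m≤n⇒m≤1+n (ℕ.m≤m+n (suc k) (countE p)) ∷ All.map ℕ.m≤n⇒m≤1+n (below-bounded -[1+ k ] p)

above-bounded : ∀ h p → All (_≤ posPart h + countN p) (above h p)
above-bounded h [] = []
above-bounded h (E ∷ p) = All.map (λ le → ℕ.≤-trans le (ℕ.+-monoˡ-≤ (countN p) (posPart-pred≤ h))) (above-bounded (ℤ.pred h) p)
above-bounded (pos k) (N ∷ p) =
  ℕ.≤-trans (s≤s (ℕ.m≤m+n k (countN p))) (ℕ.≤-reflexive (sym (ℕ.+-suc k (countN p))))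
  ∷ All.map (λ le → ℕ.≤-trans le (ℕ.≤-reflexive (sym (ℕ.+-suc k (countN p))))) (above-bounded (pos (suc k)) p)
above-bounded -[1+ zero ] (N ∷ p) = z≤n ∷ All.map ℕ.m≤n⇒m≤1+n (above-bounded (pos 0) p)
above-bounded -[1+ suc k ] (N ∷ p) = All.map ℕ.m≤n⇒m≤1+n (above-bounded -[1+ k ] p)

-- From height h a North step next records h + 1, whereas after an East step the Rise≤1 and
-- Fall≤1 bounds keep the next recorded height at most h.
N-E-distinguishable : ∀ h p p′ → below h (N ∷ p) ≡ below h (E ∷ p′) → above h (N ∷ p) ≡ above h (E ∷ p′) → ⊥
N-E-distinguishable (pos zero) p p′ _ above≡ with subst StartsWith0 (sym above≡) (above-from-negative 0 p′)
... | ()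
N-E-distinguishable (pos (suc k)) p p′ _ above≡ with subst (λ l → Linked Rise≤1 (k ∷ l)) (sym above≡) (above-rises (pos k) p′)
... | s≤s k+1≤k ∷ _ = ℕ.<-irrefl refl k+1≤k
N-E-distinguishable -[1+ zero ] p p′ below≡ _ with subst (λ l → Linked Fall≤1 (2 ∷ l)) (sym below≡) (below-falls -[1+ 1 ] p′)
... | () ∷ _
N-E-distinguishable -[1+ suc k ] p p′ below≡ _
  with subst (λ l → Linked Fall≤1 (suc (suc (suc k)) ∷ l)) (sym below≡) (below-falls -[1+ suc (suc k) ] p′)
... | s≤s k+2≤k+1 ∷ _ = ℕ.<-irrefl refl k+2≤k+1

below-above-injective : ∀ h p p′ → countN p ≡ countN p′ → countE p ≡ countE p′ →
                        below h p ≡ below h p′ → above h p ≡ above h p′ → p ≡ p′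
below-above-injective h [] [] _ _ _ _ = refl
below-above-injective h [] (N ∷ p′) () _ _ _
below-above-injective h [] (E ∷ p′) _ () _ _
below-above-injective h (N ∷ p) [] () _ _ _
below-above-injective h (E ∷ p) [] _ () _ _
below-above-injective (pos k) (N ∷ p) (N ∷ p′) cn ce below≡ above≡ =
  cong (N ∷_) (below-above-injective (pos (suc k)) p p′ (ℕ.suc-injective cn) ce below≡ (List.∷-injectiveʳ above≡))
below-above-injective -[1+ zero ] (N ∷ p) (N ∷ p′) cn ce below≡ above≡ =
  cong (N ∷_) (below-above-injective (pos 0) p p′ (ℕ.suc-injective cn) ce (List.∷-injectiveʳ below≡) (List.∷-injectiveʳ above≡))
below-above-injective -[1+ suc k ] (N ∷ p) (N ∷ p′) cn ce below≡ above≡ =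
  cong (N ∷_) (below-above-injective -[1+ k ] p p′ (ℕ.suc-injective cn) ce (List.∷-injectiveʳ below≡) above≡)
below-above-injective h (E ∷ p) (E ∷ p′) cn ce below≡ above≡ =
  cong (E ∷_) (below-above-injective (ℤ.pred h) p p′ cn (ℕ.suc-injective ce) below≡ above≡)
below-above-injective h (N ∷ p) (E ∷ p′) _ _ below≡ above≡ = ⊥-elim (N-E-distinguishable h p p′ below≡ above≡)
below-above-injective h (E ∷ p) (N ∷ p′) _ _ below≡ above≡ = ⊥-elim (N-E-distinguishable h p′ p (sym below≡) (sym above≡))

-- Rebuilding a path from its heights

Es : ℕ → List Step
Es m = replicate m E

final-Es-pos : ∀ m k → final (pos (m + k)) (Es m) ≡ pos k
final-Es-pos zero k = refl
final-Es-pos (suc m) k = final-Es-pos m k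

final-Es-neg : ∀ m j → final -[1+ j ] (Es m) ≡ -[1+ m + j ]
final-Es-neg zero j = refl
final-Es-neg (suc m) j = trans (final-Es-neg m (suc j)) (cong -[1+_] (ℕ.+-suc m j))

final-Es-pos-neg : ∀ k f → final (pos k) (Es (k + suc f)) ≡ -[1+ f ]
final-Es-pos-neg zero f = trans (final-Es-neg f 0) (cong -[1+_] (ℕ.+-identityʳ f))
final-Es-pos-neg (suc k) f = final-Es-pos-neg k f

record Decodes (h : ℤ) (F R : List ℕ) (p : List Step) : Set where
  constructor decodes
  field
    below≡ : below h p ≡ F
    above≡ : above h p ≡ R
    final≡ : final h p ≡ pos 0

decodes-Es : ∀ m {h g F R q} → final h (Es m) ≡ g → Decodes g F R q → Decodes h F R (Es m ++ q)
decodes-Es zero refl d = d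
decodes-Es (suc m) eq d with decodes-Es m eq d
... | decodes below≡ above≡ final≡ = decodes below≡ above≡ final≡

decodes-N : ∀ g {F R q} → Decodes (ℤ.suc g) F R q →
            Decodes g (nonpos [ ℤ.suc g ] ++ F) (nonneg [ ℤ.suc g ] ++ R) (N ∷ q)
decodes-N (pos k) (decodes below≡ above≡ final≡) = decodes below≡ (cong (suc k ∷_) above≡) final≡
decodes-N -[1+ zero ] (decodes below≡ above≡ final≡) = decodes (cong (0 ∷_) below≡) (cong (0 ∷_) above≡) final≡
decodes-N -[1+ suc k ] (decodes below≡ above≡ final≡) = decodes (cong (suc k ∷_) below≡) above≡ final≡

-- Below height 0 the path must return through height 0 (so the next entry of R is 0)
-- after recording a further nonpositive height.
BelowZero : ℤ → List ℕ → List ℕ → Set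
BelowZero (pos _) F R = ⊤
BelowZero -[1+ _ ] F R = StartsWith0 R × F ≢ []

record Decodable (h : ℤ) (F R : List ℕ) : Set where
  constructor decodable
  field
    falls : Linked Fall≤1 (negPart h ∷ F)
    rises : Linked Rise≤1 (posPart h ∷ R)
    belowZero : BelowZero h F R
    zeros≡ : zeros F ≡ zeros R
    endsIn0 : Zeros.EndsIn F

-- The next recorded height decides the number of East steps before the next North step: it is
-- the head of R if that is positive, otherwise the head of F (a shared head 0 is height 0).
decode : ℤ → List ℕ → List ℕ → List Step
decode (pos k) F (suc r ∷ R) = Es (k ∸ r) ++ N ∷ decode (pos (suc r)) F R
decode (pos k) (zero ∷ F) (zero ∷ R) = Es (k + 1) ++ N ∷ decode (pos 0) F R
decode (pos k) (suc f ∷ F) R = Es (k + suc (suc f)) ++ N ∷ decode -[1+ f ] F R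
decode (pos k) [] [] = Es k ++ []
decode -[1+ j ] (zero ∷ F) (zero ∷ R) = N ∷ decode (pos 0) F R
decode -[1+ j ] (suc f ∷ F) R = Es (suc f ∸ j) ++ N ∷ decode -[1+ f ] F R
decode _ _ _ = []

suc∷-nonempty : ∀ f F → Zeros.EndsIn (suc f ∷ F) → F ≢ []
suc∷-nonempty f [] ()
suc∷-nonempty f (x ∷ F) _ ()

decode-correct-pos : ∀ k F R → Decodable (pos k) F R → Decodes (pos k) F R (decode (pos k) F R)
decode-correct-neg : ∀ j F R → Decodable -[1+ j ] F R → Decodes -[1+ j ] F R (decode -[1+ j ] F R)

decode-correct-pos k F (suc r ∷ R) (decodable falls rises _ zeros≡ ends) =
  decodes-Es (k ∸ r) landing
    (decodes-N (pos r) (decode-correct-pos (suc r) F R (decodable falls (Linked.tail rises) tt zeros≡ ends)))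
  where
  landing : final (pos k) (Es (k ∸ r)) ≡ pos r
  landing = subst (λ m → final (pos m) (Es (k ∸ r)) ≡ pos r) (ℕ.m∸n+n≡m (ℕ.≤-pred (Linked.head rises)))
                  (final-Es-pos (k ∸ r) r)
decode-correct-pos k (zero ∷ F) (zero ∷ R) (decodable falls rises _ zeros≡ ends) =
  decodes-Es (k + 1) (final-Es-pos-neg k 0) (decodes-N -[1+ 0 ] (decode-correct-pos 0 F R
    (decodable (Linked.tail falls) (Linked.tail rises) tt (ℕ.suc-injective zeros≡) (Zeros.endsIn-tail 0 F ends))))
decode-correct-pos k (suc f ∷ F) (zero ∷ R) (decodable falls rises _ zeros≡ ends) =
  decodes-Es (k + suc (suc f)) (final-Es-pos-neg k (suc f)) (decodes-N -[1+ suc f ] (decode-correct-neg f F (zero ∷ R)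
    (decodable (Linked.tail falls) (z≤n ∷ Linked.tail rises) (refl , suc∷-nonempty f F ends) zeros≡
               (Zeros.endsIn-tail (suc f) F ends))))
decode-correct-pos k (suc f ∷ F) [] (decodable falls _ _ zeros≡ ends) =
  decodes-Es (k + suc (suc f)) (final-Es-pos-neg k (suc f)) (decodes-N -[1+ suc f ] (decode-correct-neg f F []
    (decodable (Linked.tail falls) [-] (tt , suc∷-nonempty f F ends) zeros≡ (Zeros.endsIn-tail (suc f) F ends))))
decode-correct-pos k [] [] _ =
  decodes-Es k (subst (λ m → final (pos m) (Es k) ≡ pos 0) (ℕ.+-identityʳ k) (final-Es-pos k 0)) (decodes refl refl refl)
decode-correct-pos k [] (zero ∷ R) (decodable _ _ _ () _)
decode-correct-pos k (zero ∷ F) [] (decodable _ _ _ () _)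

decode-correct-neg zero (zero ∷ F) (zero ∷ R) (decodable falls rises _ zeros≡ ends) =
  decodes-N -[1+ 0 ] (decode-correct-pos 0 F R
    (decodable (Linked.tail falls) (Linked.tail rises) tt (ℕ.suc-injective zeros≡) (Zeros.endsIn-tail 0 F ends)))
decode-correct-neg (suc j) (zero ∷ F) (zero ∷ R) (decodable (() ∷ _) _ _ _ _)
decode-correct-neg j (suc f ∷ F) R (decodable falls rises (starts0 , _) zeros≡ ends) =
  decodes-Es (suc f ∸ j) landing (decodes-N -[1+ suc f ] (decode-correct-neg f F R
    (decodable (Linked.tail falls) rises (starts0 , suc∷-nonempty f F ends) zeros≡ (Zeros.endsIn-tail (suc f) F ends))))
  where
  landing : final -[1+ j ] (Es (suc f ∸ j)) ≡ -[1+ suc f ]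
  landing = trans (final-Es-neg (suc f ∸ j) j) (cong -[1+_] (ℕ.m∸n+n≡m (Linked.head falls)))
decode-correct-neg j [] (suc r ∷ R) (decodable _ _ (() , _) _ _)
decode-correct-neg j (zero ∷ F) (suc r ∷ R) (decodable _ _ (() , _) _ _)
decode-correct-neg j [] [] (decodable _ _ (_ , F≢[]) _ _) = ⊥-elim (F≢[] refl)
decode-correct-neg j [] (zero ∷ R) (decodable _ _ _ () _)
decode-correct-neg j (zero ∷ F) [] (decodable _ _ _ () _)

-- The type C zeta map as a type A zeta map

letter-self : ∀ j → letter j j ≡ [ N ]
letter-self zero = refl
letter-self (suc j) = letter-self j

letter-suc : ∀ j → letter j (suc j) ≡ [ E ]
letter-suc zero = refl
letter-suc (suc j) = letter-suc j

letter-other : ∀ j m → m ≢ j → m ≢ suc j → letter j m ≡ []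
letter-other zero zero m≢j _ = ⊥-elim (m≢j refl)
letter-other zero (suc zero) _ m≢j+1 = ⊥-elim (m≢j+1 refl)
letter-other zero (suc (suc m)) _ _ = refl
letter-other (suc j) zero _ _ = refl
letter-other (suc j) (suc m) m≢j m≢j+1 = letter-other j m (m≢j ∘ cong suc) (m≢j+1 ∘ cong suc)

readPQ-∷ : ∀ p q x l → readPQ p q (x ∷ l) ≡ readPQ p q [ x ] ++ readPQ p q l
readPQ-∷ p q x l with x ℤ.≟ p | x ℤ.≟ q
... | yes _ | _ = refl
... | no _ | yes _ = refl
... | no _ | no _ = refl

readPQ-image : (f : ℕ → ℤ) → (∀ {m n} → f m ≡ f n → m ≡ n) →
               ∀ j m → readPQ (f j) (f (suc j)) [ f m ] ≡ letter j m
readPQ-image f f-injective j m with f m ℤ.≟ f j | f m ℤ.≟ f (suc j)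
... | yes fm≡fj | _ = sym (trans (cong (letter j) (f-injective fm≡fj)) (letter-self j))
... | no _ | yes fm≡fj+1 = sym (trans (cong (letter j) (f-injective fm≡fj+1)) (letter-suc j))
... | no fm≢fj | no fm≢fj+1 = sym (letter-other j m (fm≢fj ∘ cong f) (fm≢fj+1 ∘ cong f))

readPQ-nonneg : ∀ j l → readPQ (pos j) (pos (suc j)) l ≡ readLevel j (nonneg l)
readPQ-nonneg j [] = refl
readPQ-nonneg j (pos k ∷ l) = trans (readPQ-∷ (pos j) (pos (suc j)) (pos k) l)
  (cong₂ _++_ (readPQ-image pos ℤₚ.+-injective j k) (readPQ-nonneg j l))
readPQ-nonneg j (-[1+ k ] ∷ l) = readPQ-nonneg j l

neg-pos-injective : ∀ {m n} → ℤ.- pos m ≡ ℤ.- pos n → m ≡ n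
neg-pos-injective = ℤₚ.+-injective ∘ ℤₚ.neg-injective

-- The entries pos 0 and -[1+ k ] are ℤ.- pos 0 and ℤ.- pos (suc k) by definition.
readPQ-nonpos : ∀ j l → readPQ (ℤ.- pos j) (ℤ.- pos (suc j)) l ≡ readLevel j (nonpos l)
readPQ-nonpos j [] = refl
readPQ-nonpos j (pos zero ∷ l) = trans (readPQ-∷ (ℤ.- pos j) (ℤ.- pos (suc j)) (pos 0) l)
  (cong₂ _++_ (readPQ-image (ℤ.-_ ∘ pos) neg-pos-injective j 0) (readPQ-nonpos j l))
readPQ-nonpos j (pos (suc k) ∷ l) = trans (readPQ-∷ (ℤ.- pos j) (ℤ.- pos (suc j)) (pos (suc k)) l)
  (trans (cong (_++ readPQ (ℤ.- pos j) (ℤ.- pos (suc j)) l) (positive-ignored j)) (readPQ-nonpos j l))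
  where
  positive-ignored : ∀ j → readPQ (ℤ.- pos j) (ℤ.- pos (suc j)) [ pos (suc k) ] ≡ []
  positive-ignored zero = refl
  positive-ignored (suc j) = refl
readPQ-nonpos j (-[1+ k ] ∷ l) = trans (readPQ-∷ (ℤ.- pos j) (ℤ.- pos (suc j)) -[1+ k ] l)
  (cong₂ _++_ (readPQ-image (ℤ.-_ ∘ pos) neg-pos-injective j (suc k)) (readPQ-nonpos j l))

nonneg-reverseAcc : ∀ acc l → nonneg (reverseAcc acc l) ≡ reverseAcc (nonneg acc) (nonneg l)
nonneg-reverseAcc acc [] = refl
nonneg-reverseAcc acc (pos k ∷ l) = nonneg-reverseAcc (pos k ∷ acc) l
nonneg-reverseAcc acc (-[1+ k ] ∷ l) = nonneg-reverseAcc (-[1+ k ] ∷ acc) l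

zetaBlock≡readLevel : ∀ j D → SbwdMinus j (reverse D) ++ SfwdPlus j (reverse D) ≡
                              readLevel j (nonpos D ++ reverse (nonneg D))
zetaBlock≡readLevel j D = begin
  SbwdMinus j (reverse D) ++ SfwdPlus j (reverse D)
    ≡⟨ cong (λ l → readPQ (ℤ.- pos j) (ℤ.- pos (suc j)) l ++ SfwdPlus j (reverse D)) (List.reverse-involutive D) ⟩
  readPQ (ℤ.- pos j) (ℤ.- pos (suc j)) D ++ readPQ (pos j) (pos (suc j)) (reverse D)
    ≡⟨ cong₂ _++_ (readPQ-nonpos j D) (readPQ-nonneg j (reverse D)) ⟩
  readLevel j (nonpos D) ++ readLevel j (nonneg (reverse D))
    ≡⟨ cong (λ l → readLevel j (nonpos D) ++ readLevel j l) (nonneg-reverseAcc [] D) ⟩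
  readLevel j (nonpos D) ++ readLevel j (reverse (nonneg D))
    ≡⟨ readLevel-++ j (nonpos D) (reverse (nonneg D)) ⟨
  readLevel j (nonpos D ++ reverse (nonneg D)) ∎
  where open ≡-Reasoning

zetaBlocks≡zetaA : ∀ j D → zetaBlocks j (reverse D) ≡ zetaA j (nonpos D ++ reverse (nonneg D))
zetaBlocks≡zetaA zero D = zetaBlock≡readLevel 0 D
zetaBlocks≡zetaA (suc j) D = cong₂ _++_ (zetaBlock≡readLevel (suc j) D) (zetaBlocks≡zetaA j D)

zipWith-lambdasAux : ∀ (f : ℕ → ℕ) i e p → (∀ k → f k ≡ suc (i + k)) →
                     zipWith _⊖_ (applyUpTo f (countN p)) (lambdasAux e p) ≡ heights (i ⊖ e) p
zipWith-lambdasAux f i e [] _ = refl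
zipWith-lambdasAux f i e (N ∷ p) f≗ = cong₂ _∷_ (trans (cong (_⊖ e) (trans (f≗ 0) (cong suc (ℕ.+-identityʳ i)))) step-up)
  (trans (zipWith-lambdasAux (f ∘ suc) (suc i) e p λ k → trans (f≗ (suc k)) (cong suc (ℕ.+-suc i k)))
         (cong (λ h → heights h p) step-up))
  where
  step-up : suc i ⊖ e ≡ ℤ.suc (i ⊖ e)
  step-up = sym (ℤₚ.distribʳ-⊖-+-pos 1 i e)
zipWith-lambdasAux f i e (E ∷ p) f≗ = trans (zipWith-lambdasAux f i (suc e) p f≗)
  (cong (λ h → heights h p) (sym (ℤₚ.distribʳ-⊖-+-neg 0 i e)))

areaC≡reverse-heights : ∀ n π → countN π ≡ n → areaC n π ≡ reverse (heights (pos 0) π)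
areaC≡reverse-heights .(countN π) π refl = cong reverse (trans
  (cong (λ l → zipWith _⊖_ l (lambdas π)) (List.map-upTo suc (countN π)))
  (zipWith-lambdasAux suc 0 0 π λ _ → refl))

areaA : List Step → List ℕ
areaA π = below (pos 0) π ++ reverse (above (pos 0) π)

zetaC≡zetaA : ∀ n π → countN π ≡ n → zetaC n π ≡ zetaA n (areaA π)
zetaC≡zetaA n π countN≡n = trans (cong (zetaBlocks n) (areaC≡reverse-heights n π countN≡n))
  (zetaBlocks≡zetaA n (heights (pos 0) π))

fall-++ : ∀ F {Y} → Linked Fall≤1 F → Zeros.EndsIn F → Linked Fall≤1 Y → Linked Fall≤1 (F ++ Y)
fall-++ [] _ _ l = l
fall-++ (.0 ∷ []) _ refl l = fall-∷ z≤n l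
fall-++ (x ∷ y ∷ F) (r ∷ lf) e l = r ∷ fall-++ (y ∷ F) lf e l

double-injective : ∀ m n → m + m ≡ n + n → m ≡ n
double-injective m n eq = ℕ.*-cancelˡ-≡ m n 2 (trans (cong (m +_) (ℕ.+-identityʳ m))
  (trans eq (sym (cong (n +_) (ℕ.+-identityʳ n)))))

module _ (n : ℕ) (π : List Step) (countE≡n : countE π ≡ n) (countN≡n : countN π ≡ n) where

  private
    F R : List ℕ
    F = below (pos 0) π
    R = above (pos 0) π

  final≡0 : final (pos 0) π ≡ pos 0
  final≡0 = balanced⇒final≡0 (pos 0) π (trans countN≡n (sym countE≡n))

  -- Reversing R turns its Rise≤1 steps into Fall≤1 steps.
  admissible-areaA : Admissible (areaA π)
  admissible-areaA = subst (Linked Fall≤1) (sym (List.++-assoc F (reverse R) [ 0 ]))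
    (fall-++ F (Linked.tail (below-falls (pos 0) π)) (endsIn-below (pos 0) π final≡0)
      (subst (Linked Fall≤1) (List.unfold-reverse 0 R)
        (Linked.map ℕ.pred-mono-≤ (linked-reverse (above-rises (pos 0) π)))))

  bounded-areaA : All (_≤ n) (areaA π)
  bounded-areaA = All.++⁺
    (subst (λ m → All (_≤ m) F) countE≡n (below-bounded (pos 0) π))
    (All-resp-↭ (↭-sym (↭-reverse R)) (subst (λ m → All (_≤ m) R) countN≡n (above-bounded (pos 0) π)))

  weight-areaA : weight (areaA π) ≡ n + n
  weight-areaA = begin
    weight (F ++ reverse R)          ≡⟨ tally-++ _ F (reverse R) ⟩
    weight F + weight (reverse R)    ≡⟨ cong (weight F +_) (tally-reverse _ R) ⟩
    weight F + weight R              ≡⟨ weight-below+above (pos 0) π ⟩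
    countN π + countN π              ≡⟨ cong₂ _+_ countN≡n countN≡n ⟩
    n + n                            ∎
    where open ≡-Reasoning

  zeros-areaA : zeros (areaA π) ≡ zeros F + zeros F
  zeros-areaA = begin
    zeros (F ++ reverse R)         ≡⟨ Zeros.occ-++ F (reverse R) ⟩
    zeros F + zeros (reverse R)    ≡⟨ cong (zeros F +_) (Zeros.occ-reverse R) ⟩
    zeros F + zeros R              ≡⟨ cong (zeros F +_) (zeros-below≡zeros-above (pos 0) π) ⟨
    zeros F + zeros F              ∎
    where open ≡-Reasoning

zetaC-InB : ∀ n π → InL n n π → InB (2 * n) (zetaC n π)
zetaC-InB n π (countE≡n , countN≡n) = subst (InB (2 * n)) (sym (zetaC≡zetaA n π countN≡n))
  ( trans (length-zetaA n (areaA π) (bounded-areaA n π countE≡n countN≡n))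
          (trans (weight-areaA n π countE≡n countN≡n) (cong (n +_) (sym (ℕ.+-identityʳ n))))
  , ballot⇒take 0 (zetaA n (areaA π)) (zetaA-ballot n (areaA π) (bounded-areaA n π countE≡n countN≡n)))

-- areaA π = F ++ reverse R determines F: it is the prefix ending in 0 carrying half of the zeros.
zetaC-injective : ∀ n π π′ → InL n n π → InL n n π′ → zetaC n π ≡ zetaC n π′ → π ≡ π′
zetaC-injective n π π′ (countE≡n , countN≡n) (countE′≡n , countN′≡n) eq =
  below-above-injective (pos 0) π π′ (trans countN≡n (sym countN′≡n)) (trans countE≡n (sym countE′≡n)) F≡ R≡
  where
  F F′ : List ℕ
  F = below (pos 0) π
  F′ = below (pos 0) π′
  areaA≡ : areaA π ≡ areaA π′
  areaA≡ = zetaA-injective n (areaA π) (areaA π′)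
    (admissible-areaA n π countE≡n countN≡n) (admissible-areaA n π′ countE′≡n countN′≡n)
    (bounded-areaA n π countE≡n countN≡n) (bounded-areaA n π′ countE′≡n countN′≡n)
    (trans (sym (zetaC≡zetaA n π countN≡n)) (trans eq (zetaC≡zetaA n π′ countN′≡n)))
  F≡ : F ≡ F′
  F≡ = Zeros.endsIn-prefix-unique F F′ areaA≡
    (endsIn-below (pos 0) π (final≡0 n π countE≡n countN≡n))
    (endsIn-below (pos 0) π′ (final≡0 n π′ countE′≡n countN′≡n))
    (double-injective (zeros F) (zeros F′)
      (trans (sym (zeros-areaA n π countE≡n countN≡n)) (trans (cong zeros areaA≡) (zeros-areaA n π′ countE′≡n countN′≡n))))
  R≡ : above (pos 0) π ≡ above (pos 0) π′
  R≡ = List.reverse-injective (List.++-cancelˡ F _ _ (trans areaA≡ (cong (_++ reverse (above (pos 0) π′)) (sym F≡))))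

half-of-even : ∀ a c n → a + (c + c) ≡ n + n → a ≡ (n ∸ c) + (n ∸ c)
half-of-even a zero n eq = trans (sym (ℕ.+-identityʳ a)) eq
half-of-even a (suc c) zero eq = ⊥-elim (ℕ.1+n≢0 (trans (sym (ℕ.+-suc a (c + suc c))) eq))
half-of-even a (suc c) (suc n) eq = half-of-even a c n (ℕ.suc-injective (ℕ.suc-injective (begin
  suc (suc (a + (c + c)))  ≡⟨ cong suc (ℕ.+-suc a (c + c)) ⟨
  suc (a + suc (c + c))    ≡⟨ ℕ.+-suc a (suc (c + c)) ⟨
  a + suc (suc (c + c))    ≡⟨ cong (λ m → a + suc m) (ℕ.+-suc c c) ⟨
  a + (suc c + suc c)      ≡⟨ eq ⟩
  suc n + suc n            ≡⟨ cong suc (ℕ.+-suc n n) ⟩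
  suc (suc (n + n))        ∎)))
  where open ≡-Reasoning

split-decodable : ∀ b z → Admissible b → zeros b ≡ z + z →
                  Decodable (pos 0) (Zeros.through z b) (reverse (Zeros.after z b))
split-decodable b z admissible zeros≡ = decodable
  (fall-∷ z≤n (linked-++⁻ˡ F admissible-F++S))
  (subst (Linked Rise≤1) (List.reverse-++ S [ 0 ])
    (Linked.map pred≤⇒≤suc (linked-reverse (linked-++⁻ʳ F admissible-F++S))))
  tt
  (trans zeros-F (sym (trans (Zeros.occ-reverse S) zeros-S)))
  (Zeros.endsIn-through z b z≤)
  where
  F S : List ℕ
  F = Zeros.through z b
  S = Zeros.after z b
  F++S≡b : F ++ S ≡ b
  F++S≡b = Zeros.through-++-after z b
  z≤ : z ≤ zeros b
  z≤ = subst (z ≤_) (sym zeros≡) (ℕ.m≤m+n z z)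
  zeros-F : zeros F ≡ z
  zeros-F = Zeros.occ-through z b z≤
  zeros-S : zeros S ≡ z
  zeros-S = ℕ.+-cancelˡ-≡ z (zeros S) z
    (trans (cong (_+ zeros S) (sym zeros-F)) (trans (sym (Zeros.occ-++ F S)) (trans (cong zeros F++S≡b) zeros≡)))
  admissible-F++S : Linked Fall≤1 (F ++ S ++ [ 0 ])
  admissible-F++S = subst (Linked Fall≤1) (List.++-assoc F S [ 0 ]) (subst (λ c → Admissible c) (sym F++S≡b) admissible)
  pred≤⇒≤suc : ∀ {x y} → pred y ≤ x → y ≤ suc x
  pred≤⇒≤suc {y = zero} _ = z≤n
  pred≤⇒≤suc {y = suc y} le = s≤s le

areaA-surjective : ∀ n b → Admissible b → weight b ≡ n + n → ∃[ π ] (InL n n π × areaA π ≡ b)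
areaA-surjective n b admissible weight≡ = π , (trans countE≡countN countN≡n , countN≡n) , areaA≡b
  where
  z : ℕ
  z = n ∸ positives b
  zeros≡ : zeros b ≡ z + z
  zeros≡ = half-of-even (zeros b) (positives b) n (begin
    zeros b + (positives b + positives b)  ≡⟨ ℕ.+-assoc (zeros b) (positives b) (positives b) ⟨
    zeros b + positives b + positives b    ≡⟨ cong (_+ positives b) (length≡zeros+positives b) ⟨
    length b + positives b                 ≡⟨ weight≡length+positives b ⟨
    weight b                               ≡⟨ weight≡ ⟩
    n + n                                  ∎)
    where open ≡-Reasoning
  F S : List ℕ
  F = Zeros.through z b
  S = Zeros.after z b
  π : List Step
  π = decode (pos 0) F (reverse S)
  open Decodes (decode-correct-pos 0 F (reverse S) (split-decodable b z admissible zeros≡))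
  areaA≡b : areaA π ≡ b
  areaA≡b = trans (cong₂ _++_ below≡ (trans (cong reverse above≡) (List.reverse-involutive S)))
                  (Zeros.through-++-after z b)
  countN≡n : countN π ≡ n
  countN≡n = double-injective (countN π) n (begin
    countN π + countN π                                  ≡⟨ weight-below+above (pos 0) π ⟨
    weight (below (pos 0) π) + weight (above (pos 0) π)  ≡⟨ cong (weight (below (pos 0) π) +_) (tally-reverse _ (above (pos 0) π)) ⟨
    weight (below (pos 0) π) + weight (reverse (above (pos 0) π)) ≡⟨ tally-++ _ (below (pos 0) π) _ ⟨
    weight (areaA π)                                     ≡⟨ cong weight areaA≡b ⟩
    weight b                                             ≡⟨ weight≡ ⟩
    n + n                                                ∎)
    where open ≡-Reasoning
  countE≡countN : countE π ≡ countN π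
  countE≡countN = sym (final≡0⇒balanced (pos 0) π final≡)

smaller-summand≤half : ∀ a b n → a ≤ b → a + b ≡ n + n → a ≤ n
smaller-summand≤half a b n a≤b eq with a ℕ.≤? n
... | yes a≤n = a≤n
... | no a≰n = ⊥-elim (ℕ.<-irrefl (sym eq) (ℕ.+-mono-<-≤ (ℕ.≰⇒> a≰n) (ℕ.≤-trans (ℕ.<⇒≤ (ℕ.≰⇒> a≰n)) a≤b)))

zetaC-surjective : ∀ n w → InB (2 * n) w → ∃[ π ] (InL n n π × zetaC n π ≡ w)
zetaC-surjective n w (length≡ , prefixes) = π , inL , (begin
  zetaC n π         ≡⟨ zetaC≡zetaA n π (proj₂ inL) ⟩
  zetaA n (areaA π) ≡⟨ cong (zetaA n) areaA≡b ⟩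
  zetaA n b         ≡⟨ zetaA-area ⟩
  w                 ∎)
  where
  open ≡-Reasoning
  length≡n+n : length w ≡ n + n
  length≡n+n = trans length≡ (cong (n +_) (ℕ.+-identityʳ n))
  ballot : Ballot 0 w
  ballot = take⇒ballot 0 w prefixes
  countE≤n : countE w ≤ n
  countE≤n = smaller-summand≤half (countE w) (countN w) n (ballot⇒countE≤ 0 w ballot)
    (trans (ℕ.+-comm (countE w) (countN w)) (trans (sym (length≡countN+countE w)) length≡n+n))
  open ZetaAPreimage (zetaA-surjective n w ballot countE≤n) renaming (area to b)
  weight≡ : weight b ≡ n + n
  weight≡ = trans (sym (length-zetaA n b bounded)) (trans (cong length zetaA-area) length≡n+n)
  preimage : ∃[ π ] (InL n n π × areaA π ≡ b)
  preimage = areaA-surjective n b admissible weight≡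
  π : List Step
  π = proj₁ preimage
  inL : InL n n π
  inL = proj₁ (proj₂ preimage)
  areaA≡b : areaA π ≡ b
  areaA≡b = proj₂ (proj₂ preimage)

theorem4p17 : (n : ℕ) → 1 ≤ n →
    ((π : List Step) → InL n n π → InB (2 * n) (zetaC n π))
    × ((π π′ : List Step) → InL n n π → InL n n π′ → zetaC n π ≡ zetaC n π′ → π ≡ π′)
    × ((w : List Step) → InB (2 * n) w → ∃[ π ] (InL n n π × zetaC n π ≡ w))
theorem4p17 n _ = zetaC-InB n , zetaC-injective n , zetaC-surjective n
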